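{- Let $s,t$ be real numbers with $s\neq0$, $t\neq0$. For every positive integer $n$, \[ \sum_{k=1}^{n}t^{2(n-k)}\left(\frac{\{k+1\}_{s,t}+t\{k-1\}_{s,t}}{s}\right)\{k\}_{s,t}^3=\genfrac{\{}{\}}{0pt}{}{n+1}{2}_{s,t}^2. \]
   Context: The generalized Fibonacci polynomials $\{n\}_{s,t}$ are defined by $\{0\}_{s,t}=0$, $\{1\}_{s,t}=1$, $\{n+2\}_{s,t}=s\{n+1\}_{s,t}+t\{n\}_{s,t}$ (so $\{2\}_{s,t}=s$). The generalized triangular numbers are $\genfrac{\{}{\}}{0pt}{}{m}{2}_{s,t}=\frac{\{m-1\}_{s,t}\{m\}_{s,t}}{\{2\}_{s,t}}$ for integers $m\geq1$. -}

module Defs where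

open import Algebra.Bundles using (CommutativeRing)
open import Data.Nat using (ℕ; zero; suc)

module _ {c ℓ} (R : CommutativeRing c ℓ) where
  open CommutativeRing R

  -- generalized Fibonacci polynomials {n}_{s,t}
  fib : Carrier → Carrier → ℕ → Carrier
  fib s t zero = 0#
  fib s t (suc zero) = 1#
  fib s t (suc (suc n)) = s * fib s t (suc n) + t * fib s t n

  pow : Carrier → ℕ → Carrier
  pow x zero = 1#
  pow x (suc n) = x * pow x n

  sumFrom1 : ℕ → (ℕ → Carrier) → Carrier
  sumFrom1 zero f = 0#
  sumFrom1 (suc n) f = sumFrom1 n f + f (suc n)

  -- generalized triangular number {m choose 2}_{s,t} = {m-1}{m}/{2},
  -- where sInv is the inverse of {2}_{s,t} = s;  m ≥ 1 (argument given as suc m')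
  triangular : (sInv s t : Carrier) → ℕ → Carrier
  triangular sInv s t m' = (fib s t m' * fib s t (suc m')) * sInv

{-# OPTIONS --safe #-}
-- Write F k for {k}_{s,t} and u for 1/s, so that the k-th summand is
-- g k = (F (k+1) + t F (k-1)) u F k ³ and the right-hand side is T n ² with
-- T n = F n F (n+1) u.  The weighted sum S n = Σ_{k ≤ n} (t²)^(n-k) g k is the
-- solution of S 0 = 0, S (n+1) = t² S n + g (n+1), so it suffices that T ² obeys
-- the same recurrence.  With a = F (n+1), b = F n and c = F (n+2) = s a + t b,
-- (a c)² - (t a b)² = a² (c - t b) (c + t b) = s a³ (c + t b),
-- which is T (n+1)² - t² T n² = g (n+1) after multiplying by u² = u / s.
module Submission where

open import Defs
open import Algebra.Bundles using (CommutativeRing)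
open import Data.Nat as ℕ using (ℕ; zero; suc; _≤_; _∸_)
open import Data.Nat.Properties using (+-∸-assoc; n∸n≡0; *-suc; m≤n⇒m≤1+n; ≤-refl)
open import Relation.Nullary using (¬_)
open import Relation.Binary.PropositionalEquality as ≡ using (_≡_)
import Algebra.Solver.Ring.NaturalCoefficients.Default as NaturalCoefficientsSolver
import Relation.Binary.Reasoning.Setoid as SetoidReasoning

module _ {c ℓ} (R : CommutativeRing c ℓ) where
  open CommutativeRing R
  open SetoidReasoning setoid

  sumFrom1-cong : ∀ n {f g : ℕ → Carrier} → (∀ k → k ≤ n → f k ≈ g k) →
                  sumFrom1 R n f ≈ sumFrom1 R n g
  sumFrom1-cong zero    f≈g = refl
  sumFrom1-cong (suc n) f≈g =
    +-cong (sumFrom1-cong n (λ k k≤n → f≈g k (m≤n⇒m≤1+n k≤n))) (f≈g (suc n) ≤-refl)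

  *-distribˡ-sumFrom1 : ∀ q n (f : ℕ → Carrier) →
                        q * sumFrom1 R n f ≈ sumFrom1 R n (λ k → q * f k)
  *-distribˡ-sumFrom1 q zero    f = zeroʳ q
  *-distribˡ-sumFrom1 q (suc n) f =
    trans (distribˡ q _ _) (+-congʳ (*-distribˡ-sumFrom1 q n f))

  pow-double : ∀ x n → pow R x (2 ℕ.* n) ≈ pow R (x * x) n
  pow-double x zero = refl
  pow-double x (suc n) = begin
    pow R x (2 ℕ.* suc n)     ≡⟨ ≡.cong (pow R x) (*-suc 2 n) ⟩
    x * (x * pow R x (2 ℕ.* n)) ≈⟨ sym (*-assoc x x _) ⟩
    (x * x) * pow R x (2 ℕ.* n) ≈⟨ *-congˡ (pow-double x n) ⟩
    (x * x) * pow R (x * x) n ∎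

  sumFrom1-pow∸-solves-recurrence :
    ∀ q (g T : ℕ → Carrier) → T 0 ≈ 0# → (∀ n → T (suc n) ≈ q * T n + g (suc n)) →
    ∀ n → sumFrom1 R n (λ k → pow R q (n ∸ k) * g k) ≈ T n
  sumFrom1-pow∸-solves-recurrence q g T T0≈0 T-step = solves
    where
    S : ℕ → Carrier
    S n = sumFrom1 R n (λ k → pow R q (n ∸ k) * g k)

    pow-suc∸ : ∀ n k → k ≤ n → pow R q (suc n ∸ k) ≡ q * pow R q (n ∸ k)
    pow-suc∸ n k k≤n = ≡.cong (pow R q) (+-∸-assoc 1 k≤n)

    pow-n∸n : ∀ n → pow R q (n ∸ n) ≡ 1#
    pow-n∸n n = ≡.cong (pow R q) (n∸n≡0 n)

    S-step : ∀ n → S (suc n) ≈ q * S n + g (suc n)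
    S-step n = begin
      sumFrom1 R n (λ k → pow R q (suc n ∸ k) * g k) + pow R q (n ∸ n) * g (suc n)
        ≈⟨ +-cong (sumFrom1-cong n λ k k≤n →
                     trans (*-congʳ (reflexive (pow-suc∸ n k k≤n))) (*-assoc q _ _))
                  (trans (*-congʳ (reflexive (pow-n∸n n))) (*-identityˡ _)) ⟩
      sumFrom1 R n (λ k → q * (pow R q (n ∸ k) * g k)) + g (suc n)
        ≈⟨ +-congʳ (sym (*-distribˡ-sumFrom1 q n _)) ⟩
      q * S n + g (suc n) ∎

    solves : ∀ n → S n ≈ T n
    solves zero    = sym T0≈0
    solves (suc n) = trans (S-step n) (trans (+-congʳ (*-congˡ (solves n))) (sym (T-step n)))

  module _ (s t u : Carrier) where

    summand : ℕ → Carrier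
    summand k = ((fib R s t (suc k) + t * fib R s t (k ∸ 1)) * u) * pow R (fib R s t k) 3

    triangular² : ℕ → Carrier
    triangular² n = pow R (triangular R u s t n) 2

    triangular²-zero : triangular² 0 ≈ 0#
    triangular²-zero = trans (*-congʳ T0≈0) (zeroˡ _)
      where
      T0≈0 : triangular R u s t 0 ≈ 0#
      T0≈0 = trans (*-congʳ (zeroˡ 1#)) (zeroˡ u)

    triangular²-step : s * u ≈ 1# →
                       ∀ n → triangular² (suc n) ≈ (t * t) * triangular² n + summand (suc n)
    triangular²-step s*u≈1 n = begin
      triangular² (suc n)
        ≈⟨ solve 5 (λ s t u a b →
             (a :* (s :* a :+ t :* b) :* u) :* ((a :* (s :* a :+ t :* b) :* u) :* con 1)
               := (t :* t) :* ((b :* a :* u) :* ((b :* a :* u) :* con 1))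
                  :+ (s :* u) :* ((((s :* a :+ t :* b) :+ t :* b) :* u) :* (a :* (a :* (a :* con 1)))))
             refl s t u a b ⟩
      (t * t) * triangular² n + (s * u) * summand (suc n)
        ≈⟨ +-congˡ (trans (*-congʳ s*u≈1) (*-identityˡ _)) ⟩
      (t * t) * triangular² n + summand (suc n) ∎
      where
      open NaturalCoefficientsSolver commutativeSemiring
      a b : Carrier
      a = fib R s t (suc n)
      b = fib R s t n

theorem4 : ∀ {c ℓ} (R : CommutativeRing c ℓ) → let open CommutativeRing R in
    (s t sInv : Carrier) → ¬ (s ≈ 0#) → ¬ (t ≈ 0#) → s * sInv ≈ 1# →
    (n : ℕ) → 1 ≤ n →
    sumFrom1 R n (λ k → pow R t (2 ℕ.* (n ℕ.∸ k))
                         * (((fib R s t (suc k) + t * fib R s t (k ℕ.∸ 1)) * sInv)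
                            * pow R (fib R s t k) 3))
      ≈ pow R (triangular R sInv s t n) 2
theorem4 R s t u _ _ s*u≈1 n _ = begin
  sumFrom1 R n (λ k → pow R t (2 ℕ.* (n ∸ k)) * summand R s t u k)
    ≈⟨ sumFrom1-cong R n (λ k _ → *-congʳ (pow-double R t (n ∸ k))) ⟩
  sumFrom1 R n (λ k → pow R (t * t) (n ∸ k) * summand R s t u k)
    ≈⟨ sumFrom1-pow∸-solves-recurrence R (t * t) (summand R s t u) (triangular² R s t u)
         (triangular²-zero R s t u) (triangular²-step R s t u s*u≈1) n ⟩
  triangular² R s t u n ∎
  where
  open CommutativeRing R
  open SetoidReasoning setoid
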